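{- For every integer $n\geq 1$, define \[ V_{n}(x):=\frac{2(n+1)}{\binom{2n}{n}x^{n}(1-2x)}\left(Q_{n}(-x)^2-Q_{n-1}(-x)Q_{n+1}(-x)\right). \] Then \[ V_{n}(x)=\sum_{k=0}^{n-1}\frac{(n-k)(n-k+1)}{n}\binom{n-1+k}{k}x^{k}. \]
   Context: For each integer $m\geq 0$, $P_m(x),Q_m(x)\in\mathbb{Q}[x]$ denote the unique pair of polynomials with $\deg P_m\leq m$, $\deg Q_m\leq m$ satisfying $P_m(x)x^{m+1}+Q_m(x)(x+1)^{m+1}=1$. -}

module Defs where

open import Data.Nat as ℕ using (ℕ; zero; suc)
open import Data.Nat.Combinatorics using (_C_)
open import Data.Integer using (+_)
open import Data.Rational using (ℚ; 0ℚ; 1ℚ; _+_; _*_; _-_; -_; 1/_; _/_; NonZero)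
open import Data.Vec using (Vec; []; _∷_)
open import Relation.Binary.PropositionalEquality using (_≡_)

ℕ→ℚ : ℕ → ℚ
ℕ→ℚ n = (+ n) / 1

_^_ : ℚ → ℕ → ℚ
x ^ zero  = 1ℚ
x ^ suc n = x * (x ^ n)

-- A polynomial of degree ≤ m over ℚ is its vector of m+1 coefficients
-- c₀ ∷ c₁ ∷ … ∷ cₘ (coefficient of x^i at position i).
Poly : ℕ → Set
Poly m = Vec ℚ (suc m)

eval : ∀ {k} → Vec ℚ k → ℚ → ℚ
eval []       x = 0ℚ
eval (c ∷ cs) x = c + x * eval cs x

-- P, Q : families of polynomials with deg Pₘ, deg Qₘ ≤ m satisfying
-- Pₘ(x) x^{m+1} + Qₘ(x) (x+1)^{m+1} = 1  (identity of polynomials over ℚ,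
-- equivalently for every x ∈ ℚ since ℚ is infinite).
IsPQ : (P Q : (m : ℕ) → Poly m) → Set
IsPQ P Q = ∀ (m : ℕ) (x : ℚ) →
  eval (P m) x * (x ^ suc m) + eval (Q m) x * ((x + 1ℚ) ^ suc m) ≡ 1ℚ

sumBelow : ℕ → (ℕ → ℚ) → ℚ
sumBelow zero    f = 0ℚ
sumBelow (suc n) f = sumBelow n f + f n

two : ℚ
two = ℕ→ℚ 2

V : (Q : (m : ℕ) → Poly m) (n : ℕ) (x : ℚ)
    .{{_ : NonZero (ℕ→ℚ ((2 ℕ.* n) C n) * (x ^ n) * (1ℚ - two * x))}} → ℚ
V Q n x = (ℕ→ℚ (2 ℕ.* (n ℕ.+ 1))
           * (1/ (ℕ→ℚ ((2 ℕ.* n) C n) * (x ^ n) * (1ℚ - two * x))))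
          * (eval (Q n) (- x) * eval (Q n) (- x)
             - eval (Q (n ℕ.∸ 1)) (- x) * eval (Q (suc n)) (- x))

RHS : (n : ℕ) .{{_ : ℕ.NonZero n}} → ℚ → ℚ
RHS n x = sumBelow n (λ k →
  ((+ ((n ℕ.∸ k) ℕ.* (n ℕ.∸ k ℕ.+ 1))) / n)
    * ℕ→ℚ ((n ℕ.∸ 1 ℕ.+ k) C k) * (x ^ k))

module Submission where

open import Defs
open import Data.Nat as ℕ using (ℕ; zero; suc)
open import Data.Nat.Combinatorics using (_C_; nCn≡1; nCk+nC[k+1]≡[n+1]C[k+1])
import Data.Nat.Properties as ℕP
open import Data.Integer as ℤ using (+_)
import Data.Integer.Properties as ℤP
open import Data.Rational using (ℚ; 0ℚ; 1ℚ; _+_; _*_; _-_; -_; 1/_; _/_; ≢-nonZero; toℚᵘ)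
import Data.Rational.Properties as ℚP
open import Data.Rational.Properties using (toℚᵘ-injective; toℚᵘ-homo-+; toℚᵘ-homo-*; toℚᵘ-fromℚᵘ)
open import Data.Rational.Unnormalised as ℚᵘ using (mkℚᵘ; _≃_; *≡*)
import Data.Rational.Unnormalised.Properties as ℚᵘP
open import Algebra.Properties.Group ℚP.+-0-group using (x∙y⁻¹≈ε⇒x≈y; x≈y⇒x∙y⁻¹≈ε)
open import Data.List using (List; []; _∷_; map)
open import Data.Vec using (Vec; []; _∷_; fromList; zipWith)
open import Data.Product using (Σ; _,_; proj₁; proj₂)
open import Relation.Binary.PropositionalEquality hiding (J)
open import Data.Rational.Solver
open +-*-Solver

-- Write q_m(y) = Σ_{k≤m} C(m+k, k) y^k.  The proof has three parts.
--
-- (1) Q_m(x) = q_m(-x).  The table M a b = C(a+b, b) satisfies Pascal's rule,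
--     which gives the three-term recursion
--       (1 - y) q_{m+1}(y) = q_m(y) + H_m y^{m+1} (1 - 2y),   H_m = C(2m+1, m+1),
--     and from it the Bézout identity q_m(y)(1-y)^{m+1} + q_m(1-y) y^{m+1} = 1.
--     Since x^{m+1} and (x+1)^{m+1} are coprime, Bézout coefficients of degree
--     ≤ m are unique, so Q_m(x) = q_m(-x).
-- (2) Writing the right-hand side as R_n(y) = Σ_{k<n} ρ_k y^k, the absorption
--     identity for binomials shows that ρ_{j+1} - ρ_j are the coefficients of
--     (n+1) q_n(y) - 2(2n+1) y q_{n-1}(y); summation by parts then gives
--       (n+1) q_n(y) - 2(2n+1) y q_{n-1}(y) = (1 - y) R_n(y).
-- (3) Eliminating q_{n+1} and q_{n-1} from q_n² - q_{n-1} q_{n+1} with the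
--     recursion and using (2) yields, for y ≠ 1,
--       2(n+1) (q_n² - q_{n-1} q_{n+1})(y) = C(2n, n) y^n (1 - 2y) R_n(y);
--     both sides are polynomials, so by the identity theorem (a polynomial
--     vanishing at infinitely many naturals is zero) it holds for all y.
-- The theorem is this identity at y = x, divided by C(2n, n) x^n (1 - 2x).

-- The cast ℕ→ℚ is a semiring homomorphism.  ℕ→ℚ n is definitionally
-- fromℚᵘ (n/1), so it can be computed through the unnormalised fraction n/1.
ℕ→ℚᵘ : ∀ n → toℚᵘ (ℕ→ℚ n) ≃ mkℚᵘ (+ n) 0
ℕ→ℚᵘ n = toℚᵘ-fromℚᵘ (mkℚᵘ (+ n) 0)

ℕ→ℚ-+ : ∀ a b → ℕ→ℚ (a ℕ.+ b) ≡ ℕ→ℚ a + ℕ→ℚ b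
ℕ→ℚ-+ a b = toℚᵘ-injective (begin
  toℚᵘ (ℕ→ℚ (a ℕ.+ b))               ≈⟨ ℕ→ℚᵘ (a ℕ.+ b) ⟩
  mkℚᵘ (+ (a ℕ.+ b)) 0               ≈⟨ *≡* (cong (ℤ._* + 1) sum-num) ⟩
  mkℚᵘ (+ a) 0 ℚᵘ.+ mkℚᵘ (+ b) 0     ≈⟨ ℚᵘP.+-cong (ℕ→ℚᵘ a) (ℕ→ℚᵘ b) ⟨
  toℚᵘ (ℕ→ℚ a) ℚᵘ.+ toℚᵘ (ℕ→ℚ b)     ≈⟨ toℚᵘ-homo-+ (ℕ→ℚ a) (ℕ→ℚ b) ⟨
  toℚᵘ (ℕ→ℚ a + ℕ→ℚ b)               ∎)
  where
  open ℚᵘP.≃-Reasoning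
  sum-num : + (a ℕ.+ b) ≡ + a ℤ.* + 1 ℤ.+ + b ℤ.* + 1
  sum-num = trans (ℤP.pos-+ a b) (sym (cong₂ ℤ._+_ (ℤP.*-identityʳ (+ a)) (ℤP.*-identityʳ (+ b))))

ℕ→ℚ-* : ∀ a b → ℕ→ℚ (a ℕ.* b) ≡ ℕ→ℚ a * ℕ→ℚ b
ℕ→ℚ-* a b = toℚᵘ-injective (begin
  toℚᵘ (ℕ→ℚ (a ℕ.* b))               ≈⟨ ℕ→ℚᵘ (a ℕ.* b) ⟩
  mkℚᵘ (+ (a ℕ.* b)) 0               ≈⟨ *≡* (cong (ℤ._* + 1) (ℤP.pos-* a b)) ⟩
  mkℚᵘ (+ a) 0 ℚᵘ.* mkℚᵘ (+ b) 0     ≈⟨ ℚᵘP.*-cong (ℕ→ℚᵘ a) (ℕ→ℚᵘ b) ⟨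
  toℚᵘ (ℕ→ℚ a) ℚᵘ.* toℚᵘ (ℕ→ℚ b)     ≈⟨ toℚᵘ-homo-* (ℕ→ℚ a) (ℕ→ℚ b) ⟨
  toℚᵘ (ℕ→ℚ a * ℕ→ℚ b)               ∎)
  where open ℚᵘP.≃-Reasoning

ℕ→ℚ-suc : ∀ n → ℕ→ℚ (suc n) ≡ 1ℚ + ℕ→ℚ n
ℕ→ℚ-suc = ℕ→ℚ-+ 1

ℕ→ℚ-∸ : ∀ a b → b ℕ.≤ a → ℕ→ℚ (a ℕ.∸ b) ≡ ℕ→ℚ a - ℕ→ℚ b
ℕ→ℚ-∸ a b b≤a = begin
  ℕ→ℚ (a ℕ.∸ b)                    ≡⟨ solve 2 (λ X B → X := (X :+ B) :- B) refl (ℕ→ℚ (a ℕ.∸ b)) (ℕ→ℚ b) ⟩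
  (ℕ→ℚ (a ℕ.∸ b) + ℕ→ℚ b) - ℕ→ℚ b  ≡⟨ cong (_- ℕ→ℚ b) (ℕ→ℚ-+ (a ℕ.∸ b) b) ⟨
  ℕ→ℚ (a ℕ.∸ b ℕ.+ b) - ℕ→ℚ b      ≡⟨ cong (λ z → ℕ→ℚ z - ℕ→ℚ b) (ℕP.m∸n+n≡m b≤a) ⟩
  ℕ→ℚ a - ℕ→ℚ b                    ∎
  where open ≡-Reasoning

ℕ→ℚ-suc≢0 : ∀ n → ℕ→ℚ (suc n) ≢ 0ℚ
ℕ→ℚ-suc≢0 n eq with ℚᵘP.≃-trans (ℚᵘP.≃-sym (ℕ→ℚᵘ (suc n))) (ℚᵘP.≃-reflexive (cong toℚᵘ eq))
... | *≡* ()

/suc-*-cancel : ∀ a d → ((+ a) / suc d) * ℕ→ℚ (suc d) ≡ ℕ→ℚ a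
/suc-*-cancel a d = toℚᵘ-injective (begin
  toℚᵘ (((+ a) / suc d) * ℕ→ℚ (suc d))               ≈⟨ toℚᵘ-homo-* ((+ a) / suc d) (ℕ→ℚ (suc d)) ⟩
  toℚᵘ ((+ a) / suc d) ℚᵘ.* toℚᵘ (ℕ→ℚ (suc d))       ≈⟨ ℚᵘP.*-cong (toℚᵘ-fromℚᵘ (mkℚᵘ (+ a) d)) (ℕ→ℚᵘ (suc d)) ⟩
  mkℚᵘ (+ a) d ℚᵘ.* mkℚᵘ (+ suc d) 0                 ≈⟨ *≡* (assoc (+ a) (+ suc d)) ⟩
  mkℚᵘ (+ a) 0                                       ≈⟨ ℕ→ℚᵘ a ⟨
  toℚᵘ (ℕ→ℚ a)                                       ∎)
  where
  open ℚᵘP.≃-Reasoning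
  assoc : ∀ (x y : ℤ.ℤ) → (x ℤ.* y) ℤ.* + 1 ≡ x ℤ.* (y ℤ.* + 1)
  assoc x y = ℤP.*-assoc x y (+ 1)

≢0-*-≡0 : ∀ a b → a ≢ 0ℚ → a * b ≡ 0ℚ → b ≡ 0ℚ
≢0-*-≡0 a b a≢0 ab≡0 = begin
  b                  ≡⟨ ℚP.*-identityˡ b ⟨
  1ℚ * b             ≡⟨ cong (_* b) (ℚP.*-inverseˡ a {{≢-nonZero a≢0}}) ⟨
  (a⁻¹ * a) * b      ≡⟨ ℚP.*-assoc a⁻¹ a b ⟩
  a⁻¹ * (a * b)      ≡⟨ cong (a⁻¹ *_) ab≡0 ⟩
  a⁻¹ * 0ℚ           ≡⟨ ℚP.*-zeroʳ a⁻¹ ⟩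
  0ℚ                 ∎
  where
  open ≡-Reasoning
  a⁻¹ : ℚ
  a⁻¹ = (1/ a) {{≢-nonZero a≢0}}

*-≢0 : ∀ a b → a ≢ 0ℚ → b ≢ 0ℚ → a * b ≢ 0ℚ
*-≢0 a b a≢0 b≢0 ab≡0 = b≢0 (≢0-*-≡0 a b a≢0 ab≡0)

*-cancelˡ-≢0 : ∀ a b c → a ≢ 0ℚ → a * b ≡ a * c → b ≡ c
*-cancelˡ-≢0 a b c a≢0 ab≡ac = x∙y⁻¹≈ε⇒x≈y b c (≢0-*-≡0 a (b - c) a≢0 (begin
  a * (b - c)        ≡⟨ solve 3 (λ A B C → A :* (B :- C) := A :* B :- A :* C) refl a b c ⟩
  a * b - a * c      ≡⟨ cong (_- a * c) ab≡ac ⟩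
  a * c - a * c      ≡⟨ ℚP.+-inverseʳ (a * c) ⟩
  0ℚ                 ∎))
  where open ≡-Reasoning

divide-out : ∀ t w d r (d≢0 : d ≢ 0ℚ) → t * w ≡ d * r → (t * (1/ d) {{≢-nonZero d≢0}}) * w ≡ r
divide-out t w d r d≢0 tw≡dr = begin
  (t * d⁻¹) * w      ≡⟨ solve 3 (λ T I W → (T :* I) :* W := I :* (T :* W)) refl t d⁻¹ w ⟩
  d⁻¹ * (t * w)      ≡⟨ cong (d⁻¹ *_) tw≡dr ⟩
  d⁻¹ * (d * r)      ≡⟨ ℚP.*-assoc d⁻¹ d r ⟨
  (d⁻¹ * d) * r      ≡⟨ cong (_* r) (ℚP.*-inverseˡ d {{≢-nonZero d≢0}}) ⟩
  1ℚ * r             ≡⟨ ℚP.*-identityˡ r ⟩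
  r                  ∎
  where
  open ≡-Reasoning
  d⁻¹ : ℚ
  d⁻¹ = (1/ d) {{≢-nonZero d≢0}}

1^n≡1 : ∀ n → 1ℚ ^ n ≡ 1ℚ
1^n≡1 zero    = refl
1^n≡1 (suc n) = cong (1ℚ *_) (1^n≡1 n)

^-distribʳ-* : ∀ a b n → (a * b) ^ n ≡ a ^ n * b ^ n
^-distribʳ-* a b zero    = refl
^-distribʳ-* a b (suc n) = begin
  (a * b) * (a * b) ^ n      ≡⟨ cong ((a * b) *_) (^-distribʳ-* a b n) ⟩
  (a * b) * (a ^ n * b ^ n)  ≡⟨ solve 4 (λ A B X Y → (A :* B) :* (X :* Y) := (A :* X) :* (B :* Y)) refl a b (a ^ n) (b ^ n) ⟩
  (a * a ^ n) * (b * b ^ n)  ∎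
  where open ≡-Reasoning

sumBelow-cong : ∀ n (f g : ℕ → ℚ) → (∀ k → k ℕ.< n → f k ≡ g k) → sumBelow n f ≡ sumBelow n g
sumBelow-cong zero    f g f≡g = refl
sumBelow-cong (suc n) f g f≡g =
  cong₂ _+_ (sumBelow-cong n f g (λ k k<n → f≡g k (ℕP.m<n⇒m<1+n k<n))) (f≡g n ℕP.≤-refl)

sumBelow-suc : ∀ n (f : ℕ → ℚ) → sumBelow (suc n) f ≡ f 0 + sumBelow n (λ k → f (suc k))
sumBelow-suc zero    f = ℚP.+-comm 0ℚ (f 0)
sumBelow-suc (suc n) f = begin
  sumBelow (suc n) f + f (suc n)                      ≡⟨ cong (_+ f (suc n)) (sumBelow-suc n f) ⟩
  (f 0 + sumBelow n (λ k → f (suc k))) + f (suc n)    ≡⟨ ℚP.+-assoc (f 0) _ (f (suc n)) ⟩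
  f 0 + sumBelow (suc n) (λ k → f (suc k))            ∎
  where open ≡-Reasoning

sumBelow-+ : ∀ n (f g : ℕ → ℚ) → sumBelow n (λ k → f k + g k) ≡ sumBelow n f + sumBelow n g
sumBelow-+ zero    f g = refl
sumBelow-+ (suc n) f g = begin
  sumBelow n (λ k → f k + g k) + (f n + g n)    ≡⟨ cong (_+ (f n + g n)) (sumBelow-+ n f g) ⟩
  (sumBelow n f + sumBelow n g) + (f n + g n)   ≡⟨ solve 4 (λ A B C D → (A :+ B) :+ (C :+ D) := (A :+ C) :+ (B :+ D)) refl (sumBelow n f) (sumBelow n g) (f n) (g n) ⟩
  (sumBelow n f + f n) + (sumBelow n g + g n)   ∎
  where open ≡-Reasoning

sumBelow-scale : ∀ n c (f : ℕ → ℚ) → c * sumBelow n f ≡ sumBelow n (λ k → c * f k)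
sumBelow-scale zero    c f = ℚP.*-zeroʳ c
sumBelow-scale (suc n) c f = begin
  c * (sumBelow n f + f n)       ≡⟨ ℚP.*-distribˡ-+ c (sumBelow n f) (f n) ⟩
  c * sumBelow n f + c * f n     ≡⟨ cong (_+ c * f n) (sumBelow-scale n c f) ⟩
  sumBelow n (λ k → c * f k) + c * f n ∎
  where open ≡-Reasoning

sumBelow-lincomb : ∀ n c d (f g : ℕ → ℚ) →
  c * sumBelow n f - d * sumBelow n g ≡ sumBelow n (λ k → c * f k - d * g k)
sumBelow-lincomb zero    c d f g = solve 2 (λ C D → C :* con 0ℚ :- D :* con 0ℚ := con 0ℚ) refl c d
sumBelow-lincomb (suc n) c d f g = begin
  c * (F + f n) - d * (G + g n)         ≡⟨ solve 6 (λ C D F G X Y → C :* (F :+ X) :- D :* (G :+ Y) := (C :* F :- D :* G) :+ (C :* X :- D :* Y)) refl c d F G (f n) (g n) ⟩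
  (c * F - d * G) + (c * f n - d * g n) ≡⟨ cong (_+ (c * f n - d * g n)) (sumBelow-lincomb n c d f g) ⟩
  sumBelow (suc n) (λ k → c * f k - d * g k) ∎
  where
  open ≡-Reasoning
  F G : ℚ
  F = sumBelow n f
  G = sumBelow n g

y*sumBelow : ∀ n (a : ℕ → ℚ) y → y * sumBelow n (λ k → a k * y ^ k) ≡ sumBelow n (λ k → a k * y ^ suc k)
y*sumBelow n a y = trans (sumBelow-scale n y (λ k → a k * y ^ k))
  (sumBelow-cong n _ _ (λ k _ → solve 3 (λ Y A P → Y :* (A :* P) := A :* (Y :* P)) refl y (a k) (y ^ k)))

summation-by-parts : ∀ n (ρ : ℕ → ℚ) y →
  (1ℚ - y) * sumBelow n (λ k → ρ k * y ^ k) + ρ n * y ^ n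
    ≡ ρ 0 + sumBelow n (λ k → (ρ (suc k) - ρ k) * y ^ suc k)
summation-by-parts zero    ρ y = solve 2 (λ Y R → (con 1ℚ :- Y) :* con 0ℚ :+ R :* con 1ℚ := R :+ con 0ℚ) refl y (ρ 0)
summation-by-parts (suc n) ρ y = begin
  (1ℚ - y) * (S + ρ n * y ^ n) + ρ (suc n) * (y * y ^ n)
    ≡⟨ solve 5 (λ Y S R R' P → (con 1ℚ :- Y) :* (S :+ R :* P) :+ R' :* (Y :* P) := ((con 1ℚ :- Y) :* S :+ R :* P) :+ (R' :- R) :* (Y :* P)) refl y S (ρ n) (ρ (suc n)) (y ^ n) ⟩
  ((1ℚ - y) * S + ρ n * y ^ n) + (ρ (suc n) - ρ n) * y ^ suc n
    ≡⟨ cong (_+ (ρ (suc n) - ρ n) * y ^ suc n) (summation-by-parts n ρ y) ⟩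
  (ρ 0 + D) + (ρ (suc n) - ρ n) * y ^ suc n
    ≡⟨ ℚP.+-assoc (ρ 0) D _ ⟩
  ρ 0 + sumBelow (suc n) (λ k → (ρ (suc k) - ρ k) * y ^ suc k) ∎
  where
  open ≡-Reasoning
  S D : ℚ
  S = sumBelow n (λ k → ρ k * y ^ k)
  D = sumBelow n (λ k → (ρ (suc k) - ρ k) * y ^ suc k)

-- Polynomial functions.  A list c₀ ∷ c₁ ∷ … denotes Σ cᵢ xⁱ; ring operations
-- on coefficient lists show that polynomial functions are closed under the
-- ring operations.

evalL : List ℚ → ℚ → ℚ
evalL []       x = 0ℚ
evalL (c ∷ cs) x = c + x * evalL cs x

addL : List ℚ → List ℚ → List ℚ
addL []      q       = q
addL (a ∷ p) []      = a ∷ p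
addL (a ∷ p) (b ∷ q) = (a + b) ∷ addL p q

evalL-addL : ∀ p q x → evalL (addL p q) x ≡ evalL p x + evalL q x
evalL-addL []      q       x = sym (ℚP.+-identityˡ _)
evalL-addL (a ∷ p) []      x = sym (ℚP.+-identityʳ _)
evalL-addL (a ∷ p) (b ∷ q) x = begin
  (a + b) + x * evalL (addL p q) x          ≡⟨ cong (λ z → (a + b) + x * z) (evalL-addL p q x) ⟩
  (a + b) + x * (evalL p x + evalL q x)     ≡⟨ solve 5 (λ A B X P Q → (A :+ B) :+ X :* (P :+ Q) := (A :+ X :* P) :+ (B :+ X :* Q)) refl a b x (evalL p x) (evalL q x) ⟩
  (a + x * evalL p x) + (b + x * evalL q x) ∎
  where open ≡-Reasoning

evalL-scale : ∀ c p x → evalL (map (c *_) p) x ≡ c * evalL p x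
evalL-scale c []      x = sym (ℚP.*-zeroʳ c)
evalL-scale c (a ∷ p) x = begin
  c * a + x * evalL (map (c *_) p) x  ≡⟨ cong (λ z → c * a + x * z) (evalL-scale c p x) ⟩
  c * a + x * (c * evalL p x)         ≡⟨ solve 4 (λ C A X P → C :* A :+ X :* (C :* P) := C :* (A :+ X :* P)) refl c a x (evalL p x) ⟩
  c * (a + x * evalL p x)             ∎
  where open ≡-Reasoning

mulL : List ℚ → List ℚ → List ℚ
mulL []      q = []
mulL (a ∷ p) q = addL (map (a *_) q) (0ℚ ∷ mulL p q)

evalL-mulL : ∀ p q x → evalL (mulL p q) x ≡ evalL p x * evalL q x
evalL-mulL []      q x = sym (ℚP.*-zeroˡ (evalL q x))
evalL-mulL (a ∷ p) q x = begin
  evalL (addL (map (a *_) q) (0ℚ ∷ mulL p q)) x              ≡⟨ evalL-addL (map (a *_) q) (0ℚ ∷ mulL p q) x ⟩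
  evalL (map (a *_) q) x + (0ℚ + x * evalL (mulL p q) x)     ≡⟨ cong₂ (λ u v → u + (0ℚ + x * v)) (evalL-scale a q x) (evalL-mulL p q x) ⟩
  a * evalL q x + (0ℚ + x * (evalL p x * evalL q x))         ≡⟨ solve 4 (λ A Q X P → A :* Q :+ (con 0ℚ :+ X :* (P :* Q)) := (A :+ X :* P) :* Q) refl a (evalL q x) x (evalL p x) ⟩
  (a + x * evalL p x) * evalL q x                            ∎
  where open ≡-Reasoning

IsPoly : (ℚ → ℚ) → Set
IsPoly f = Σ (List ℚ) (λ cs → ∀ x → f x ≡ evalL cs x)

poly-ext : ∀ {f g} → (∀ x → g x ≡ f x) → IsPoly f → IsPoly g
poly-ext g≡f (cs , f≡cs) = cs , λ x → trans (g≡f x) (f≡cs x)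

poly-const : ∀ c → IsPoly (λ _ → c)
poly-const c = (c ∷ []) , λ x → solve 2 (λ C X → C := C :+ X :* con 0ℚ) refl c x

poly-id : IsPoly (λ x → x)
poly-id = (0ℚ ∷ 1ℚ ∷ []) , λ x → solve 1 (λ X → X := con 0ℚ :+ X :* (con 1ℚ :+ X :* con 0ℚ)) refl x

poly-+ : ∀ {f g} → IsPoly f → IsPoly g → IsPoly (λ x → f x + g x)
poly-+ (l , f≡l) (m , g≡m) = addL l m , λ x → trans (cong₂ _+_ (f≡l x) (g≡m x)) (sym (evalL-addL l m x))

poly-* : ∀ {f g} → IsPoly f → IsPoly g → IsPoly (λ x → f x * g x)
poly-* (l , f≡l) (m , g≡m) = mulL l m , λ x → trans (cong₂ _*_ (f≡l x) (g≡m x)) (sym (evalL-mulL l m x))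

poly-- : ∀ {f g} → IsPoly f → IsPoly g → IsPoly (λ x → f x - g x)
poly-- {f} {g} pf pg = poly-ext (λ x → solve 2 (λ F G → F :- G := F :+ con (- 1ℚ) :* G) refl (f x) (g x))
                                (poly-+ pf (poly-* (poly-const (- 1ℚ)) pg))

poly-^ : ∀ {f} → IsPoly f → ∀ k → IsPoly (λ x → f x ^ k)
poly-^ pf zero    = poly-const 1ℚ
poly-^ pf (suc k) = poly-* pf (poly-^ pf k)

poly-sum : ∀ n (f : ℕ → ℚ → ℚ) → (∀ k → IsPoly (f k)) → IsPoly (λ x → sumBelow n (λ k → f k x))
poly-sum zero    f pf = poly-const 0ℚ
poly-sum (suc n) f pf = poly-+ (poly-sum n f pf) (pf n)

poly-eval : ∀ {k} (v : Vec ℚ k) → IsPoly (eval v)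
poly-eval []       = [] , λ x → refl
poly-eval (c ∷ cs) with poly-eval cs
... | l , cs≡l = (c ∷ l) , λ x → cong (λ z → c + x * z) (cs≡l x)

quot : ∀ {k} → ℚ → Vec ℚ (suc k) → Vec ℚ k
rem  : ∀ {k} → ℚ → Vec ℚ (suc k) → ℚ
quot a (c ∷ [])     = []
quot a (c ∷ d ∷ cs) = rem a (d ∷ cs) ∷ quot a (d ∷ cs)
rem  a (c ∷ [])     = c
rem  a (c ∷ d ∷ cs) = c + a * rem a (d ∷ cs)

division : ∀ {k} a (p : Vec ℚ (suc k)) x → eval p x ≡ (x - a) * eval (quot a p) x + rem a p
division a (c ∷ [])     x = solve 3 (λ C X A → C :+ X :* con 0ℚ := (X :- A) :* con 0ℚ :+ C) refl c x a
division a (c ∷ d ∷ cs) x = begin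
  c + x * eval (d ∷ cs) x         ≡⟨ cong (λ z → c + x * z) (division a (d ∷ cs) x) ⟩
  c + x * ((x - a) * q + r)       ≡⟨ solve 5 (λ C X A Q R → C :+ X :* ((X :- A) :* Q :+ R) := (X :- A) :* (R :+ X :* Q) :+ (C :+ A :* R)) refl c x a q r ⟩
  (x - a) * (r + x * q) + (c + a * r) ∎
  where
  open ≡-Reasoning
  q r : ℚ
  q = eval (quot a (d ∷ cs)) x
  r = rem a (d ∷ cs)

rem-at-root : ∀ {k} a (p : Vec ℚ (suc k)) → eval p a ≡ 0ℚ → rem a p ≡ 0ℚ
rem-at-root a p pa≡0 = begin
  rem a p                                 ≡⟨ solve 3 (λ A Q R → R := (A :- A) :* Q :+ R) refl a (eval (quot a p) a) (rem a p) ⟩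
  (a - a) * eval (quot a p) a + rem a p   ≡⟨ division a p a ⟨
  eval p a                                ≡⟨ pa≡0 ⟩
  0ℚ                                      ∎
  where open ≡-Reasoning

-- A polynomial vanishing at all the naturals s, s+1, s+2, … vanishes
-- identically: factor out the root s and recurse on the quotient, which has
-- one coefficient fewer and vanishes at s+1, s+2, ….
vanishing-on-naturals : ∀ {k} (p : Vec ℚ k) s → (∀ i → eval p (ℕ→ℚ (s ℕ.+ i)) ≡ 0ℚ) → ∀ x → eval p x ≡ 0ℚ
vanishing-on-naturals []            s p≡0 x = refl
vanishing-on-naturals p@(_ ∷ _) s p≡0 x = begin
  eval p x                        ≡⟨ division a p x ⟩
  (x - a) * eval (quot a p) x + r ≡⟨ cong₂ (λ u v → (x - a) * u + v) (vanishing-on-naturals (quot a p) (suc s) quot≡0 x) r≡0 ⟩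
  (x - a) * 0ℚ + 0ℚ               ≡⟨ solve 2 (λ X A → (X :- A) :* con 0ℚ :+ con 0ℚ := con 0ℚ) refl x a ⟩
  0ℚ                              ∎
  where
  open ≡-Reasoning
  a r : ℚ
  a = ℕ→ℚ s
  r = rem a p
  r≡0 : r ≡ 0ℚ
  r≡0 = rem-at-root a p (trans (cong (λ z → eval p (ℕ→ℚ z)) (sym (ℕP.+-identityʳ s))) (p≡0 0))
  quot≡0 : ∀ i → eval (quot a p) (ℕ→ℚ (suc s ℕ.+ i)) ≡ 0ℚ
  quot≡0 i = ≢0-*-≡0 (y - a) (eval (quot a p) y) y-a≢0 (begin
    (y - a) * eval (quot a p) y       ≡⟨ solve 1 (λ U → U := U :+ con 0ℚ) refl _ ⟩
    (y - a) * eval (quot a p) y + 0ℚ  ≡⟨ cong (λ z → (y - a) * eval (quot a p) y + z) r≡0 ⟨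
    (y - a) * eval (quot a p) y + r   ≡⟨ division a p y ⟨
    eval p y                          ≡⟨ cong (λ z → eval p (ℕ→ℚ z)) (sym (ℕP.+-suc s i)) ⟩
    eval p (ℕ→ℚ (s ℕ.+ suc i))        ≡⟨ p≡0 (suc i) ⟩
    0ℚ                                ∎)
    where
    y : ℚ
    y = ℕ→ℚ (suc s ℕ.+ i)
    y-a≢0 : y - a ≢ 0ℚ
    y-a≢0 eq = ℕ→ℚ-suc≢0 i (begin
      ℕ→ℚ (suc i)                     ≡⟨ solve 2 (λ A I → I := (A :+ I) :- A) refl a (ℕ→ℚ (suc i)) ⟩
      (a + ℕ→ℚ (suc i)) - a           ≡⟨ cong (_- a) (ℕ→ℚ-+ s (suc i)) ⟨
      ℕ→ℚ (s ℕ.+ suc i) - a           ≡⟨ cong (λ z → ℕ→ℚ z - a) (ℕP.+-suc s i) ⟩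
      y - a                           ≡⟨ eq ⟩
      0ℚ                              ∎)

poly-identity : ∀ {f g} → IsPoly f → IsPoly g → ∀ s →
  (∀ i → f (ℕ→ℚ (s ℕ.+ i)) ≡ g (ℕ→ℚ (s ℕ.+ i))) → ∀ x → f x ≡ g x
poly-identity {f} {g} pf pg s f≡g x = x∙y⁻¹≈ε⇒x≈y (f x) (g x) (begin
  f x - g x                   ≡⟨ d≡cs x ⟩
  evalL cs x                  ≡⟨ evalL-fromList cs x ⟨
  eval (fromList cs) x        ≡⟨ vanishing-on-naturals (fromList cs) s cs≡0 x ⟩
  0ℚ                          ∎)
  where
  open ≡-Reasoning
  evalL-fromList : ∀ (l : List ℚ) x → eval (fromList l) x ≡ evalL l x
  evalL-fromList []      x = refl
  evalL-fromList (c ∷ l) x = cong (λ z → c + x * z) (evalL-fromList l x)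
  difference : IsPoly (λ y → f y - g y)
  difference = poly-- pf pg
  cs : List ℚ
  cs = proj₁ difference
  d≡cs : ∀ y → f y - g y ≡ evalL cs y
  d≡cs = proj₂ difference
  cs≡0 : ∀ i → eval (fromList cs) (ℕ→ℚ (s ℕ.+ i)) ≡ 0ℚ
  cs≡0 i = trans (evalL-fromList cs _) (trans (sym (d≡cs _)) (x≈y⇒x∙y⁻¹≈ε (f≡g i)))

-- M a b = C(a+b, b), defined by the symmetric Pascal recursion
-- M(a+1,b+1) = M(a,b+1) + M(a+1,b).
M : ℕ → ℕ → ℕ
M zero    b       = 1
M (suc a) zero    = 1
M (suc a) (suc b) = M a (suc b) ℕ.+ M (suc a) b

M≡C : ∀ a b → M a b ≡ (a ℕ.+ b) C b
M≡C zero    b       = sym (nCn≡1 b)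
M≡C (suc a) zero    = refl
M≡C (suc a) (suc b) = begin
  M a (suc b) ℕ.+ M (suc a) b                      ≡⟨ cong₂ ℕ._+_ (M≡C a (suc b)) (M≡C (suc a) b) ⟩
  (a ℕ.+ suc b) C suc b ℕ.+ suc (a ℕ.+ b) C b      ≡⟨ cong (λ z → (a ℕ.+ suc b) C suc b ℕ.+ z C b) (ℕP.+-suc a b) ⟨
  (a ℕ.+ suc b) C suc b ℕ.+ (a ℕ.+ suc b) C b      ≡⟨ ℕP.+-comm _ ((a ℕ.+ suc b) C b) ⟩
  (a ℕ.+ suc b) C b ℕ.+ (a ℕ.+ suc b) C suc b      ≡⟨ nCk+nC[k+1]≡[n+1]C[k+1] (a ℕ.+ suc b) b ⟩
  suc (a ℕ.+ suc b) C suc b                        ∎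
  where open ≡-Reasoning

M-zeroʳ : ∀ a → M a 0 ≡ 1
M-zeroʳ zero    = refl
M-zeroʳ (suc a) = refl

M-sym : ∀ a b → M a b ≡ M b a
M-sym zero    zero    = refl
M-sym zero    (suc b) = refl
M-sym (suc a) zero    = refl
M-sym (suc a) (suc b) = trans (cong₂ ℕ._+_ (M-sym a (suc b)) (M-sym (suc a) b)) (ℕP.+-comm (M (suc b) a) (M b (suc a)))

-- Absorption (a+1)·M(a+1,b) = (a+1+b)·M(a,b).  The recursive calls swap a
-- and b, so the induction is on a bound n ≥ a+b.
absorption-below : ∀ n a b → a ℕ.+ b ℕ.≤ n → suc a ℕ.* M (suc a) b ≡ (suc a ℕ.+ b) ℕ.* M a b
absorption-below n       a zero    _ rewrite M-zeroʳ a | ℕP.+-identityʳ a = refl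
absorption-below zero    a (suc b) le with () ← ℕP.≤-trans (ℕP.≤-reflexive (sym (ℕP.+-suc a b))) le
absorption-below (suc n) a (suc b) le = begin
  suc a ℕ.* (X ℕ.+ Y)                   ≡⟨ ℕP.*-distribˡ-+ (suc a) X Y ⟩
  suc a ℕ.* X ℕ.+ suc a ℕ.* Y           ≡⟨ cong (suc a ℕ.* X ℕ.+_) (absorption-below n a b a+b≤n) ⟩
  suc a ℕ.* X ℕ.+ (suc a ℕ.+ b) ℕ.* Z   ≡⟨ cong (suc a ℕ.* X ℕ.+_) swapped ⟨
  suc a ℕ.* X ℕ.+ suc b ℕ.* X           ≡⟨ ℕP.*-distribʳ-+ X (suc a) (suc b) ⟨
  (suc a ℕ.+ suc b) ℕ.* X               ∎
  where
  open ≡-Reasoning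
  X Y Z : ℕ
  X = M a (suc b)
  Y = M (suc a) b
  Z = M a b
  a+b≤n : a ℕ.+ b ℕ.≤ n
  a+b≤n = ℕP.≤-pred (ℕP.≤-trans (ℕP.≤-reflexive (sym (ℕP.+-suc a b))) le)
  swapped : suc b ℕ.* X ≡ (suc a ℕ.+ b) ℕ.* Z
  swapped = begin
    suc b ℕ.* X                 ≡⟨ cong (suc b ℕ.*_) (M-sym a (suc b)) ⟩
    suc b ℕ.* M (suc b) a       ≡⟨ absorption-below n b a (ℕP.≤-trans (ℕP.≤-reflexive (ℕP.+-comm b a)) a+b≤n) ⟩
    (suc b ℕ.+ a) ℕ.* M b a     ≡⟨ cong₂ ℕ._*_ (cong suc (ℕP.+-comm b a)) (M-sym b a) ⟩
    (suc a ℕ.+ b) ℕ.* Z         ∎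

absorption : ∀ a b → suc a ℕ.* M (suc a) b ≡ (suc a ℕ.+ b) ℕ.* M a b
absorption a b = absorption-below (a ℕ.+ b) a b ℕP.≤-refl

-- The polynomials q_m(y) = Σ_{k≤m} C(m+k,k) y^k; it will turn out that
-- Q_m(x) = q_m(-x).
q : ℕ → ℚ → ℚ
q m y = sumBelow (suc m) (λ k → ℕ→ℚ (M m k) * y ^ k)

H : ℕ → ℚ
H m = ℕ→ℚ (M m (suc m))

M-diagonal : ∀ m → ℕ→ℚ (M (suc m) (suc m)) ≡ H m + H m
M-diagonal m = trans (ℕ→ℚ-+ (M m (suc m)) (M (suc m) m)) (cong (λ z → H m + ℕ→ℚ z) (M-sym (suc m) m))

q-pascal : ∀ m y → q (suc m) y ≡ (q m y + H m * y ^ suc m) + y * (q (suc m) y - (H m + H m) * y ^ suc m)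
q-pascal m y = begin
  q (suc m) y                                              ≡⟨ sumBelow-suc (suc m) F ⟩
  F 0 + sumBelow (suc m) (λ j → F (suc j))                 ≡⟨ cong (λ z → F 0 + z) (sumBelow-cong (suc m) _ _ (λ j _ → pascal j)) ⟩
  F 0 + sumBelow (suc m) (λ j → G (suc j) + y * F j)       ≡⟨ cong (λ z → F 0 + z) (sumBelow-+ (suc m) (λ j → G (suc j)) (λ j → y * F j)) ⟩
  F 0 + (ΣG' + sumBelow (suc m) (λ j → y * F j))           ≡⟨ ℚP.+-assoc (F 0) ΣG' _ ⟨
  (F 0 + ΣG') + sumBelow (suc m) (λ j → y * F j)           ≡⟨ cong₂ _+_ (cong (_+ ΣG') F0≡G0) (sym (sumBelow-scale (suc m) y F)) ⟩
  (G 0 + ΣG') + y * sumBelow (suc m) F                     ≡⟨ cong₂ (λ u v → u + y * v) (sym (sumBelow-suc (suc m) G)) ΣF ⟩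
  (q m y + H m * y ^ suc m) + y * (q (suc m) y - (H m + H m) * y ^ suc m) ∎
  where
  open ≡-Reasoning
  F G : ℕ → ℚ
  F k = ℕ→ℚ (M (suc m) k) * y ^ k
  G k = ℕ→ℚ (M m k) * y ^ k
  ΣG' : ℚ
  ΣG' = sumBelow (suc m) (λ j → G (suc j))
  pascal : ∀ j → F (suc j) ≡ G (suc j) + y * F j
  pascal j = begin
    ℕ→ℚ (M m (suc j) ℕ.+ M (suc m) j) * (y * y ^ j)              ≡⟨ cong (_* (y * y ^ j)) (ℕ→ℚ-+ (M m (suc j)) (M (suc m) j)) ⟩
    (ℕ→ℚ (M m (suc j)) + ℕ→ℚ (M (suc m) j)) * (y * y ^ j)       ≡⟨ solve 4 (λ A B Y P → (A :+ B) :* (Y :* P) := A :* (Y :* P) :+ Y :* (B :* P)) refl (ℕ→ℚ (M m (suc j))) (ℕ→ℚ (M (suc m) j)) y (y ^ j) ⟩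
    G (suc j) + y * F j                                          ∎
  F0≡G0 : F 0 ≡ G 0
  F0≡G0 = cong (λ z → ℕ→ℚ z * 1ℚ) (trans (M-zeroʳ (suc m)) (sym (M-zeroʳ m)))
  ΣF : sumBelow (suc m) F ≡ q (suc m) y - (H m + H m) * y ^ suc m
  ΣF = begin
    sumBelow (suc m) F                        ≡⟨ solve 2 (λ S T → S := (S :+ T) :- T) refl (sumBelow (suc m) F) (F (suc m)) ⟩
    q (suc m) y - F (suc m)                   ≡⟨ cong (λ z → q (suc m) y - z * y ^ suc m) (M-diagonal m) ⟩
    q (suc m) y - (H m + H m) * y ^ suc m     ∎

q-step : ∀ m y → (1ℚ - y) * q (suc m) y ≡ q m y + H m * y ^ suc m * (1ℚ - (y + y))
q-step m y = begin
  (1ℚ - y) * q₁                          ≡⟨ solve 2 (λ Y Q → (con 1ℚ :- Y) :* Q := Q :- Y :* Q) refl y q₁ ⟩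
  q₁ - y * q₁                            ≡⟨ cong (_- y * q₁) (q-pascal m y) ⟩
  (q m y + H m * Y + y * (q₁ - (H m + H m) * Y)) - y * q₁
    ≡⟨ solve 5 (λ y q₀ q₁ h Y → (q₀ :+ h :* Y :+ y :* (q₁ :- (h :+ h) :* Y)) :- y :* q₁ := q₀ :+ h :* Y :* (con 1ℚ :- (y :+ y))) refl y (q m y) q₁ (H m) Y ⟩
  q m y + H m * Y * (1ℚ - (y + y))       ∎
  where
  open ≡-Reasoning
  q₁ Y : ℚ
  q₁ = q (suc m) y
  Y = y ^ suc m

-- Bézout identity q_m(y)(1-y)^{m+1} + q_m(1-y) y^{m+1} = 1, by induction on m:
-- the step follows from q-step at y and at 1 - y.
q-bezout : ∀ m y → q m y * (1ℚ - y) ^ suc m + q m (1ℚ - y) * y ^ suc m ≡ 1ℚ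
q-bezout zero    y = solve 1 (λ Y → (con 0ℚ :+ con 1ℚ :* con 1ℚ) :* ((con 1ℚ :- Y) :* con 1ℚ) :+ (con 0ℚ :+ con 1ℚ :* con 1ℚ) :* (Y :* con 1ℚ) := con 1ℚ) refl y
q-bezout (suc m) y = begin
  A₁ * ((1ℚ - y) * Z) + B₁ * (y * Y)
    ≡⟨ solve 5 (λ y A₁ B₁ Y Z → A₁ :* ((con 1ℚ :- y) :* Z) :+ B₁ :* (y :* Y) := Z :* ((con 1ℚ :- y) :* A₁) :+ Y :* ((con 1ℚ :- (con 1ℚ :- y)) :* B₁)) refl y A₁ B₁ Y Z ⟩
  Z * ((1ℚ - y) * A₁) + Y * ((1ℚ - (1ℚ - y)) * B₁)
    ≡⟨ cong₂ (λ u v → Z * u + Y * v) (q-step m y) (q-step m (1ℚ - y)) ⟩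
  Z * (A₀ + h * Y * (1ℚ - (y + y))) + Y * (B₀ + h * Z * (1ℚ - ((1ℚ - y) + (1ℚ - y))))
    ≡⟨ solve 6 (λ y A₀ B₀ h Y Z → Z :* (A₀ :+ h :* Y :* (con 1ℚ :- (y :+ y))) :+ Y :* (B₀ :+ h :* Z :* (con 1ℚ :- ((con 1ℚ :- y) :+ (con 1ℚ :- y)))) := A₀ :* Z :+ B₀ :* Y) refl y A₀ B₀ h Y Z ⟩
  A₀ * Z + B₀ * Y                        ≡⟨ q-bezout m y ⟩
  1ℚ                                     ∎
  where
  open ≡-Reasoning
  A₀ A₁ B₀ B₁ h Y Z : ℚ
  A₀ = q m y
  A₁ = q (suc m) y
  B₀ = q m (1ℚ - y)
  B₁ = q (suc m) (1ℚ - y)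
  h = H m
  Y = y ^ suc m
  Z = (1ℚ - y) ^ suc m

-- Coprimality of x^k and (x+1)^j: if A(x)·x^k = B(x)·(x+1)^j with A a
-- polynomial function and B of degree < k, then B = 0.  Evaluating at 0 kills
-- the constant coefficient of B; dividing by x (first at the positive
-- naturals, then everywhere by the identity theorem) lowers k.
coprime-powers : ∀ {k} j (B : Vec ℚ k) (A : ℚ → ℚ) → IsPoly A →
  (∀ x → A x * x ^ k ≡ eval B x * (x + 1ℚ) ^ j) → ∀ x → eval B x ≡ 0ℚ
coprime-powers j []      A pA AB x = refl
coprime-powers {suc k} j (b ∷ B) A pA AB x = begin
  b + x * eval B x      ≡⟨ cong₂ (λ u v → u + x * v) b≡0 (coprime-powers j B A pA AB' x) ⟩
  0ℚ + x * 0ℚ           ≡⟨ solve 1 (λ X → con 0ℚ :+ X :* con 0ℚ := con 0ℚ) refl x ⟩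
  0ℚ                    ∎
  where
  open ≡-Reasoning
  b≡0 : b ≡ 0ℚ
  b≡0 = begin
    b                                       ≡⟨ solve 2 (λ B E → B := (B :+ con 0ℚ :* E) :* con 1ℚ) refl b (eval B 0ℚ) ⟩
    (b + 0ℚ * eval B 0ℚ) * 1ℚ               ≡⟨ cong (λ z → (b + 0ℚ * eval B 0ℚ) * z) (1^n≡1 j) ⟨
    (b + 0ℚ * eval B 0ℚ) * (0ℚ + 1ℚ) ^ j    ≡⟨ AB 0ℚ ⟨
    A 0ℚ * (0ℚ * 0ℚ ^ k)                    ≡⟨ solve 2 (λ U V → U :* (con 0ℚ :* V) := con 0ℚ) refl (A 0ℚ) (0ℚ ^ k) ⟩
    0ℚ                                      ∎
  AB-positive : ∀ i → let y = ℕ→ℚ (1 ℕ.+ i) in A y * y ^ k ≡ eval B y * (y + 1ℚ) ^ j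
  AB-positive i = *-cancelˡ-≢0 y _ _ (ℕ→ℚ-suc≢0 i) (begin
    y * (A y * y ^ k)                       ≡⟨ solve 3 (λ Y U V → Y :* (U :* V) := U :* (Y :* V)) refl y (A y) (y ^ k) ⟩
    A y * (y * y ^ k)                       ≡⟨ AB y ⟩
    (b + y * eval B y) * (y + 1ℚ) ^ j       ≡⟨ cong (λ z → (z + y * eval B y) * (y + 1ℚ) ^ j) b≡0 ⟩
    (0ℚ + y * eval B y) * (y + 1ℚ) ^ j      ≡⟨ solve 3 (λ Y U V → (con 0ℚ :+ Y :* U) :* V := Y :* (U :* V)) refl y (eval B y) ((y + 1ℚ) ^ j) ⟩
    y * (eval B y * (y + 1ℚ) ^ j)           ∎)
    where
    y : ℚ
    y = ℕ→ℚ (1 ℕ.+ i)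
  AB' : ∀ y → A y * y ^ k ≡ eval B y * (y + 1ℚ) ^ j
  AB' = poly-identity (poly-* pA (poly-^ poly-id k))
                      (poly-* (poly-eval B) (poly-^ (poly-+ poly-id (poly-const 1ℚ)) j)) 1 AB-positive

coeffs : (n : ℕ) → (ℕ → ℚ) → Vec ℚ n
coeffs zero    a = []
coeffs (suc n) a = a 0 ∷ coeffs n (λ k → a (suc k))

eval-coeffs : ∀ n a x → eval (coeffs n a) x ≡ sumBelow n (λ k → a k * x ^ k)
eval-coeffs zero    a x = refl
eval-coeffs (suc n) a x = begin
  a 0 + x * eval (coeffs n (λ k → a (suc k))) x       ≡⟨ cong (λ z → a 0 + x * z) (eval-coeffs n (λ k → a (suc k)) x) ⟩
  a 0 + x * sumBelow n (λ k → a (suc k) * x ^ k)      ≡⟨ cong₂ _+_ (sym (ℚP.*-identityʳ (a 0))) (y*sumBelow n (λ k → a (suc k)) x) ⟩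
  a 0 * 1ℚ + sumBelow n (λ k → a (suc k) * x ^ suc k) ≡⟨ sumBelow-suc n (λ k → a k * x ^ k) ⟨
  sumBelow (suc n) (λ k → a k * x ^ k)                ∎
  where open ≡-Reasoning

eval-zipWith- : ∀ {k} (u v : Vec ℚ k) x → eval (zipWith _-_ u v) x ≡ eval u x - eval v x
eval-zipWith- []      []      x = refl
eval-zipWith- (a ∷ u) (b ∷ v) x = begin
  (a - b) + x * eval (zipWith _-_ u v) x  ≡⟨ cong (λ z → (a - b) + x * z) (eval-zipWith- u v x) ⟩
  (a - b) + x * (eval u x - eval v x)     ≡⟨ solve 5 (λ A B X U V → (A :- B) :+ X :* (U :- V) := (A :+ X :* U) :- (B :+ X :* V)) refl a b x (eval u x) (eval v x) ⟩
  (a + x * eval u x) - (b + x * eval v x) ∎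
  where open ≡-Reasoning

q-reflected : (m : ℕ) → Poly m
q-reflected m = coeffs (suc m) (λ k → ℕ→ℚ (M m k) * (- 1ℚ) ^ k)

eval-q-reflected : ∀ m x → eval (q-reflected m) x ≡ q m (- x)
eval-q-reflected m x = trans (eval-coeffs (suc m) (λ k → ℕ→ℚ (M m k) * (- 1ℚ) ^ k) x) (sumBelow-cong (suc m) _ _ (λ k _ → begin
  ℕ→ℚ (M m k) * (- 1ℚ) ^ k * x ^ k       ≡⟨ ℚP.*-assoc (ℕ→ℚ (M m k)) ((- 1ℚ) ^ k) (x ^ k) ⟩
  ℕ→ℚ (M m k) * ((- 1ℚ) ^ k * x ^ k)     ≡⟨ cong (ℕ→ℚ (M m k) *_) (^-distribʳ-* (- 1ℚ) x k) ⟨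
  ℕ→ℚ (M m k) * ((- 1ℚ) * x) ^ k         ≡⟨ cong (λ z → ℕ→ℚ (M m k) * z ^ k) (solve 1 (λ X → con (- 1ℚ) :* X := :- X) refl x) ⟩
  ℕ→ℚ (M m k) * (- x) ^ k                ∎))
  where open ≡-Reasoning

q-bezout-reflected : ∀ m x → q m (- x) * (x + 1ℚ) ^ suc m + q m (x + 1ℚ) * ((- 1ℚ) ^ suc m * x ^ suc m) ≡ 1ℚ
q-bezout-reflected m x = begin
  q m (- x) * (x + 1ℚ) ^ suc m + q m (x + 1ℚ) * ((- 1ℚ) ^ suc m * x ^ suc m)
    ≡⟨ cong₂ (λ u v → q m (- x) * u ^ suc m + q m u * v) 1+x (^-distribʳ-* (- 1ℚ) x (suc m)) ⟨
  q m (- x) * (1ℚ - - x) ^ suc m + q m (1ℚ - - x) * ((- 1ℚ) * x) ^ suc m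
    ≡⟨ cong (λ z → q m (- x) * (1ℚ - - x) ^ suc m + q m (1ℚ - - x) * z ^ suc m) (solve 1 (λ X → con (- 1ℚ) :* X := :- X) refl x) ⟩
  q m (- x) * (1ℚ - - x) ^ suc m + q m (1ℚ - - x) * (- x) ^ suc m
    ≡⟨ q-bezout m (- x) ⟩
  1ℚ ∎
  where
  open ≡-Reasoning
  1+x : 1ℚ - - x ≡ x + 1ℚ
  1+x = solve 1 (λ X → con 1ℚ :- (:- X) := X :+ con 1ℚ) refl x

poly-q : ∀ m {g} → IsPoly g → IsPoly (λ x → q m (g x))
poly-q m {g} pg = poly-sum (suc m) (λ k x → ℕ→ℚ (M m k) * g x ^ k)
                           (λ k → poly-* (poly-const (ℕ→ℚ (M m k))) (poly-^ pg k))

bezout-difference : ∀ p₁ q₁ q₂ r s X W → p₁ * X + q₁ * W ≡ 1ℚ → q₂ * W + r * (s * X) ≡ 1ℚ →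
  (r * s - p₁) * X ≡ (q₁ - q₂) * W
bezout-difference p₁ q₁ q₂ r s X W bez₁ bez₂ = begin
  (r * s - p₁) * X
    ≡⟨ solve 7 (λ p₁ q₁ q₂ r s X W → (r :* s :- p₁) :* X := (q₂ :* W :+ r :* (s :* X)) :- (p₁ :* X :+ q₁ :* W) :+ (q₁ :- q₂) :* W) refl p₁ q₁ q₂ r s X W ⟩
  (q₂ * W + r * (s * X)) - (p₁ * X + q₁ * W) + (q₁ - q₂) * W  ≡⟨ cong₂ (λ u v → u - v + (q₁ - q₂) * W) bez₂ bez₁ ⟩
  1ℚ - 1ℚ + (q₁ - q₂) * W                                     ≡⟨ solve 1 (λ T → con 1ℚ :- con 1ℚ :+ T := T) refl ((q₁ - q₂) * W) ⟩
  (q₁ - q₂) * W                                               ∎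
  where open ≡-Reasoning

-- Comparing the defining
-- identity of P_m, Q_m with q-bezout-reflected shows that Q_m(x) - q_m(-x),
-- of degree ≤ m, times (x+1)^{m+1} is a multiple of x^{m+1}; so it vanishes.
Q≡q : ∀ P Q → IsPQ P Q → ∀ m x → eval (Q m) x ≡ q m (- x)
Q≡q P Q isPQ m x = x∙y⁻¹≈ε⇒x≈y (eval (Q m) x) (q m (- x)) (begin
  eval (Q m) x - q m (- x)                  ≡⟨ cong (λ z → eval (Q m) x - z) (eval-q-reflected m x) ⟨
  eval (Q m) x - eval (q-reflected m) x     ≡⟨ eval-zipWith- (Q m) (q-reflected m) x ⟨
  eval D x                                  ≡⟨ coprime-powers (suc m) D A poly-A syzygy x ⟩
  0ℚ                                        ∎)
  where
  open ≡-Reasoning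
  D : Poly m
  D = zipWith _-_ (Q m) (q-reflected m)
  A : ℚ → ℚ
  A y = q m (y + 1ℚ) * (- 1ℚ) ^ suc m - eval (P m) y
  poly-A : IsPoly A
  poly-A = poly-- (poly-* (poly-q m (poly-+ poly-id (poly-const 1ℚ))) (poly-const _)) (poly-eval (P m))
  syzygy : ∀ y → A y * y ^ suc m ≡ eval D y * (y + 1ℚ) ^ suc m
  syzygy y = begin
    A y * y ^ suc m
      ≡⟨ bezout-difference (eval (P m) y) (eval (Q m) y) (q m (- y)) (q m (y + 1ℚ)) ((- 1ℚ) ^ suc m) (y ^ suc m) ((y + 1ℚ) ^ suc m) (isPQ m y) (q-bezout-reflected m y) ⟩
    (eval (Q m) y - q m (- y)) * (y + 1ℚ) ^ suc m              ≡⟨ cong (λ z → (eval (Q m) y - z) * (y + 1ℚ) ^ suc m) (eval-q-reflected m y) ⟨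
    (eval (Q m) y - eval (q-reflected m) y) * (y + 1ℚ) ^ suc m ≡⟨ cong (_* (y + 1ℚ) ^ suc m) (eval-zipWith- (Q m) (q-reflected m) y) ⟨
    eval D y * (y + 1ℚ) ^ suc m                                ∎

-- The rational identity behind the coefficient recursion of the right-hand
-- side; N stands for n, J for j, a, b, c for C(p+j, j), C(p+j+1, j+1),
-- C(n+j+1, j+1) (p = n - 1), related by the two absorption identities, and u = 1/n.
ρ-step-algebra : ∀ N J a b c u → N ≢ 0ℚ → 1ℚ + J ≢ 0ℚ →
  N * c ≡ (N + (1ℚ + J)) * b → (1ℚ + J) * b ≡ (J + N) * a → N * u ≡ 1ℚ →
  (1ℚ + N) * c - ((N + (1ℚ + N)) + (N + (1ℚ + N))) * a
    ≡ (N - (1ℚ + J)) * ((N - (1ℚ + J)) + 1ℚ) * u * b - (N - J) * ((N - J) + 1ℚ) * u * a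
ρ-step-algebra N J a b c u N≢0 B≢0 hc hb hu =
  *-cancelˡ-≢0 (N * (1ℚ + J)) _ _ (*-≢0 N (1ℚ + J) N≢0 B≢0) (trans lhs (sym rhs))
  where
  open ≡-Reasoning
  common : ℚ
  common = (1ℚ + N) * (N + (1ℚ + J)) * ((J + N) * a) - ((N + (1ℚ + N)) + (N + (1ℚ + N))) * N * (1ℚ + J) * a
  lhs : N * (1ℚ + J) * ((1ℚ + N) * c - ((N + (1ℚ + N)) + (N + (1ℚ + N))) * a) ≡ common
  lhs = begin
    N * (1ℚ + J) * ((1ℚ + N) * c - ((N + (1ℚ + N)) + (N + (1ℚ + N))) * a)
      ≡⟨ solve 4 (λ N J a c → let B = con 1ℚ :+ J ; κ = (N :+ (con 1ℚ :+ N)) :+ (N :+ (con 1ℚ :+ N)) in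
                   N :* B :* ((con 1ℚ :+ N) :* c :- κ :* a) := (con 1ℚ :+ N) :* B :* (N :* c) :- κ :* N :* B :* a) refl N J a c ⟩
    (1ℚ + N) * (1ℚ + J) * (N * c) - ((N + (1ℚ + N)) + (N + (1ℚ + N))) * N * (1ℚ + J) * a
      ≡⟨ cong (λ z → (1ℚ + N) * (1ℚ + J) * z - ((N + (1ℚ + N)) + (N + (1ℚ + N))) * N * (1ℚ + J) * a) hc ⟩
    (1ℚ + N) * (1ℚ + J) * ((N + (1ℚ + J)) * b) - ((N + (1ℚ + N)) + (N + (1ℚ + N))) * N * (1ℚ + J) * a
      ≡⟨ solve 4 (λ N J a b → let B = con 1ℚ :+ J ; κ = (N :+ (con 1ℚ :+ N)) :+ (N :+ (con 1ℚ :+ N)) in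
                   (con 1ℚ :+ N) :* B :* ((N :+ B) :* b) :- κ :* N :* B :* a := (con 1ℚ :+ N) :* (N :+ B) :* (B :* b) :- κ :* N :* B :* a) refl N J a b ⟩
    (1ℚ + N) * (N + (1ℚ + J)) * ((1ℚ + J) * b) - ((N + (1ℚ + N)) + (N + (1ℚ + N))) * N * (1ℚ + J) * a
      ≡⟨ cong (λ z → (1ℚ + N) * (N + (1ℚ + J)) * z - ((N + (1ℚ + N)) + (N + (1ℚ + N))) * N * (1ℚ + J) * a) hb ⟩
    common ∎
  rhs : N * (1ℚ + J) * ((N - (1ℚ + J)) * ((N - (1ℚ + J)) + 1ℚ) * u * b - (N - J) * ((N - J) + 1ℚ) * u * a) ≡ common
  rhs = begin
    N * (1ℚ + J) * ((N - (1ℚ + J)) * ((N - (1ℚ + J)) + 1ℚ) * u * b - (N - J) * ((N - J) + 1ℚ) * u * a)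
      ≡⟨ solve 5 (λ N J a b u → let B = con 1ℚ :+ J in
                   N :* B :* ((N :- B) :* ((N :- B) :+ con 1ℚ) :* u :* b :- (N :- J) :* ((N :- J) :+ con 1ℚ) :* u :* a)
                   := (N :* u) :* ((N :- B) :* ((N :- B) :+ con 1ℚ) :* (B :* b) :- (N :- J) :* ((N :- J) :+ con 1ℚ) :* B :* a)) refl N J a b u ⟩
    (N * u) * ((N - (1ℚ + J)) * ((N - (1ℚ + J)) + 1ℚ) * ((1ℚ + J) * b) - (N - J) * ((N - J) + 1ℚ) * (1ℚ + J) * a)
      ≡⟨ cong₂ (λ s t → s * ((N - (1ℚ + J)) * ((N - (1ℚ + J)) + 1ℚ) * t - (N - J) * ((N - J) + 1ℚ) * (1ℚ + J) * a)) hu hb ⟩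
    1ℚ * ((N - (1ℚ + J)) * ((N - (1ℚ + J)) + 1ℚ) * ((J + N) * a) - (N - J) * ((N - J) + 1ℚ) * (1ℚ + J) * a)
      ≡⟨ solve 3 (λ N J a → let B = con 1ℚ :+ J ; κ = (N :+ (con 1ℚ :+ N)) :+ (N :+ (con 1ℚ :+ N)) in
                   con 1ℚ :* ((N :- B) :* ((N :- B) :+ con 1ℚ) :* ((J :+ N) :* a) :- (N :- J) :* ((N :- J) :+ con 1ℚ) :* B :* a)
                   := (con 1ℚ :+ N) :* (N :+ B) :* ((J :+ N) :* a) :- κ :* N :* B :* a) refl N J a ⟩
    common ∎

-- The coefficients of the right-hand side for n = p + 1 and their recursion.
module RHS-Coefficients (p : ℕ) where

  N : ℚ
  N = ℕ→ℚ (suc p)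

  N≢0 : N ≢ 0ℚ
  N≢0 = ℕ→ℚ-suc≢0 p

  u : ℚ
  u = (1/ N) {{≢-nonZero N≢0}}

  Nu≡1 : N * u ≡ 1ℚ
  Nu≡1 = ℚP.*-inverseʳ N {{≢-nonZero N≢0}}

  -- ρ_k = (n-k)(n-k+1)/n · C(p+k, k), extended beyond k = n - 1 by the same formula.
  ρ : ℕ → ℚ
  ρ k = (N - ℕ→ℚ k) * ((N - ℕ→ℚ k) + 1ℚ) * u * ℕ→ℚ (M p k)

  RHS≡Σρ : ∀ y → RHS (suc p) y ≡ sumBelow (suc p) (λ k → ρ k * y ^ k)
  RHS≡Σρ y = sumBelow-cong (suc p) _ _ (λ k k<n → cong (_* y ^ k) (coefficient k (ℕP.<⇒≤ k<n)))
    where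
    open ≡-Reasoning
    coefficient : ∀ k → k ℕ.≤ suc p →
      ((+ ((suc p ℕ.∸ k) ℕ.* (suc p ℕ.∸ k ℕ.+ 1))) / suc p) * ℕ→ℚ ((p ℕ.+ k) C k) ≡ ρ k
    coefficient k k≤n = begin
      ((+ (d ℕ.* (d ℕ.+ 1))) / suc p) * ℕ→ℚ ((p ℕ.+ k) C k)  ≡⟨ cong₂ _*_ divide (cong ℕ→ℚ (M≡C p k)) ⟨
      ℕ→ℚ (d ℕ.* (d ℕ.+ 1)) * u * ℕ→ℚ (M p k)               ≡⟨ cong (λ z → z * u * ℕ→ℚ (M p k)) (trans (ℕ→ℚ-* d (d ℕ.+ 1)) (cong (ℕ→ℚ d *_) (ℕ→ℚ-+ d 1))) ⟩
      ℕ→ℚ d * (ℕ→ℚ d + 1ℚ) * u * ℕ→ℚ (M p k)                ≡⟨ cong (λ z → z * (z + 1ℚ) * u * ℕ→ℚ (M p k)) (ℕ→ℚ-∸ (suc p) k k≤n) ⟩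
      ρ k                                                    ∎
      where
      d : ℕ
      d = suc p ℕ.∸ k
      divide : ℕ→ℚ (d ℕ.* (d ℕ.+ 1)) * u ≡ (+ (d ℕ.* (d ℕ.+ 1))) / suc p
      divide = begin
        ℕ→ℚ (d ℕ.* (d ℕ.+ 1)) * u                   ≡⟨ cong (_* u) (/suc-*-cancel (d ℕ.* (d ℕ.+ 1)) p) ⟨
        (((+ (d ℕ.* (d ℕ.+ 1))) / suc p) * N) * u   ≡⟨ ℚP.*-assoc ((+ (d ℕ.* (d ℕ.+ 1))) / suc p) N u ⟩
        ((+ (d ℕ.* (d ℕ.+ 1))) / suc p) * (N * u)   ≡⟨ cong (((+ (d ℕ.* (d ℕ.+ 1))) / suc p) *_) Nu≡1 ⟩
        ((+ (d ℕ.* (d ℕ.+ 1))) / suc p) * 1ℚ        ≡⟨ ℚP.*-identityʳ ((+ (d ℕ.* (d ℕ.+ 1))) / suc p) ⟩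
        (+ (d ℕ.* (d ℕ.+ 1))) / suc p               ∎

  -- Boundary values ρ_n = 0 and ρ_0 = n + 1, needed for summation by parts.
  ρ-top : ρ (suc p) ≡ 0ℚ
  ρ-top = solve 3 (λ X U A → (X :- X) :* ((X :- X) :+ con 1ℚ) :* U :* A := con 0ℚ) refl N u (ℕ→ℚ (M p (suc p)))

  ρ-bottom : ρ 0 ≡ 1ℚ + N
  ρ-bottom = begin
    (N - 0ℚ) * ((N - 0ℚ) + 1ℚ) * u * ℕ→ℚ (M p 0) ≡⟨ cong (λ z → (N - 0ℚ) * ((N - 0ℚ) + 1ℚ) * u * ℕ→ℚ z) (M-zeroʳ p) ⟩
    (N - 0ℚ) * ((N - 0ℚ) + 1ℚ) * u * 1ℚ          ≡⟨ solve 2 (λ X U → (X :- con 0ℚ) :* ((X :- con 0ℚ) :+ con 1ℚ) :* U :* con 1ℚ := (X :* U) :* (con 1ℚ :+ X)) refl N u ⟩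
    (N * u) * (1ℚ + N)                           ≡⟨ cong (_* (1ℚ + N)) Nu≡1 ⟩
    1ℚ * (1ℚ + N)                                ≡⟨ ℚP.*-identityˡ (1ℚ + N) ⟩
    1ℚ + N                                       ∎
    where open ≡-Reasoning

  κ : ℚ
  κ = (N + (1ℚ + N)) + (N + (1ℚ + N))

  ρ-step : ∀ j → (1ℚ + N) * ℕ→ℚ (M (suc p) (suc j)) - κ * ℕ→ℚ (M p j) ≡ ρ (suc j) - ρ j
  ρ-step j = begin
    (1ℚ + N) * c - κ * a
      ≡⟨ ρ-step-algebra N J a b c u N≢0 B≢0 hc hb Nu≡1 ⟩
    (N - (1ℚ + J)) * ((N - (1ℚ + J)) + 1ℚ) * u * b - (N - J) * ((N - J) + 1ℚ) * u * a
      ≡⟨ cong (λ B → (N - B) * ((N - B) + 1ℚ) * u * b - (N - J) * ((N - J) + 1ℚ) * u * a) (ℕ→ℚ-suc j) ⟨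
    ρ (suc j) - ρ j ∎
    where
    open ≡-Reasoning
    J a b c : ℚ
    J = ℕ→ℚ j
    a = ℕ→ℚ (M p j)
    b = ℕ→ℚ (M p (suc j))
    c = ℕ→ℚ (M (suc p) (suc j))
    B≢0 : 1ℚ + J ≢ 0ℚ
    B≢0 eq = ℕ→ℚ-suc≢0 j (trans (ℕ→ℚ-suc j) eq)
    hc : N * c ≡ (N + (1ℚ + J)) * b
    hc = begin
      N * c                                  ≡⟨ ℕ→ℚ-* (suc p) (M (suc p) (suc j)) ⟨
      ℕ→ℚ (suc p ℕ.* M (suc p) (suc j))      ≡⟨ cong ℕ→ℚ (absorption p (suc j)) ⟩
      ℕ→ℚ ((suc p ℕ.+ suc j) ℕ.* M p (suc j)) ≡⟨ ℕ→ℚ-* (suc p ℕ.+ suc j) (M p (suc j)) ⟩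
      ℕ→ℚ (suc p ℕ.+ suc j) * b              ≡⟨ cong (_* b) (trans (ℕ→ℚ-+ (suc p) (suc j)) (cong (λ z → N + z) (ℕ→ℚ-suc j))) ⟩
      (N + (1ℚ + J)) * b                     ∎
    hb : (1ℚ + J) * b ≡ (J + N) * a
    hb = begin
      (1ℚ + J) * b                           ≡⟨ cong₂ _*_ (ℕ→ℚ-suc j) (cong ℕ→ℚ (M-sym (suc j) p)) ⟨
      ℕ→ℚ (suc j) * ℕ→ℚ (M (suc j) p)        ≡⟨ ℕ→ℚ-* (suc j) (M (suc j) p) ⟨
      ℕ→ℚ (suc j ℕ.* M (suc j) p)            ≡⟨ cong ℕ→ℚ (absorption j p) ⟩
      ℕ→ℚ ((suc j ℕ.+ p) ℕ.* M j p)          ≡⟨ cong (λ z → ℕ→ℚ (z ℕ.* M j p)) (ℕP.+-suc j p) ⟨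
      ℕ→ℚ ((j ℕ.+ suc p) ℕ.* M j p)          ≡⟨ ℕ→ℚ-* (j ℕ.+ suc p) (M j p) ⟩
      ℕ→ℚ (j ℕ.+ suc p) * ℕ→ℚ (M j p)        ≡⟨ cong₂ _*_ (ℕ→ℚ-+ j (suc p)) (cong ℕ→ℚ (M-sym j p)) ⟩
      (J + N) * a                            ∎

  coefficient-identity : ∀ y → (1ℚ + N) * q (suc p) y - κ * (y * q p y) ≡ (1ℚ - y) * RHS (suc p) y
  coefficient-identity y = begin
    (1ℚ + N) * q (suc p) y - κ * (y * q p y)
      ≡⟨ cong₂ (λ s t → (1ℚ + N) * s - κ * t) q-split (y*sumBelow (suc p) (λ k → ℕ→ℚ (M p k)) y) ⟩
    (1ℚ + N) * (1ℚ + S₁) - κ * S₂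
      ≡⟨ solve 4 (λ A K X Y → A :* (con 1ℚ :+ X) :- K :* Y := A :+ (A :* X :- K :* Y)) refl (1ℚ + N) κ S₁ S₂ ⟩
    (1ℚ + N) + ((1ℚ + N) * S₁ - κ * S₂)
      ≡⟨ cong₂ _+_ (sym ρ-bottom) (sumBelow-lincomb (suc p) (1ℚ + N) κ _ _) ⟩
    ρ 0 + sumBelow (suc p) (λ j → (1ℚ + N) * (ℕ→ℚ (M (suc p) (suc j)) * y ^ suc j) - κ * (ℕ→ℚ (M p j) * y ^ suc j))
      ≡⟨ cong (λ z → ρ 0 + z) (sumBelow-cong (suc p) _ _ (λ j _ → collect j)) ⟩
    ρ 0 + sumBelow (suc p) (λ j → (ρ (suc j) - ρ j) * y ^ suc j)
      ≡⟨ summation-by-parts (suc p) ρ y ⟨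
    (1ℚ - y) * Σρ + ρ (suc p) * y ^ suc p
      ≡⟨ cong (λ z → (1ℚ - y) * Σρ + z * y ^ suc p) ρ-top ⟩
    (1ℚ - y) * Σρ + 0ℚ * y ^ suc p
      ≡⟨ solve 2 (λ X Z → X :+ con 0ℚ :* Z := X) refl ((1ℚ - y) * Σρ) (y ^ suc p) ⟩
    (1ℚ - y) * Σρ
      ≡⟨ cong ((1ℚ - y) *_) (RHS≡Σρ y) ⟨
    (1ℚ - y) * RHS (suc p) y ∎
    where
    open ≡-Reasoning
    S₁ S₂ Σρ : ℚ
    S₁ = sumBelow (suc p) (λ j → ℕ→ℚ (M (suc p) (suc j)) * y ^ suc j)
    S₂ = sumBelow (suc p) (λ j → ℕ→ℚ (M p j) * y ^ suc j)
    Σρ = sumBelow (suc p) (λ k → ρ k * y ^ k)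
    q-split : q (suc p) y ≡ 1ℚ + S₁
    q-split = trans (sumBelow-suc (suc p) (λ k → ℕ→ℚ (M (suc p) k) * y ^ k)) (cong (_+ S₁) (ℚP.*-identityʳ 1ℚ))
    collect : ∀ j → (1ℚ + N) * (ℕ→ℚ (M (suc p) (suc j)) * y ^ suc j) - κ * (ℕ→ℚ (M p j) * y ^ suc j)
                    ≡ (ρ (suc j) - ρ j) * y ^ suc j
    collect j = trans (solve 5 (λ A K X Z Y → A :* (X :* Y) :- K :* (Z :* Y) := (A :* X :- K :* Z) :* Y) refl
                              (1ℚ + N) κ (ℕ→ℚ (M (suc p) (suc j))) (ℕ→ℚ (M p j)) (y ^ suc j))
                      (cong (_* y ^ suc j) (ρ-step j))

W : ℕ → ℚ → ℚ
W p y = q (suc p) y * q (suc p) y - q p y * q (suc (suc p)) y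

-- Eliminating q_{n+1} and q_{n-1} with q-step turns (1 - y)·2c·W into
-- (1 - y)·2H Y (1 - 2y) R, given the coefficient identity c q_n - κ y q_{n-1} = (1-y) R
-- and the ratio c H_n = (κ/2)·2H_{n-1}.
W-algebra : ∀ y q₀ q₁ q₂ h₀ h₁ Y R c κ/2 →
  (1ℚ - y) * q₁ ≡ q₀ + h₀ * Y * (1ℚ - (y + y)) →
  (1ℚ - y) * q₂ ≡ q₁ + h₁ * (y * Y) * (1ℚ - (y + y)) →
  c * h₁ ≡ κ/2 * (h₀ + h₀) →
  c * q₁ - (κ/2 + κ/2) * (y * q₀) ≡ (1ℚ - y) * R →
  1ℚ - y ≢ 0ℚ →
  (c + c) * (q₁ * q₁ - q₀ * q₂) ≡ (h₀ + h₀) * Y * (1ℚ - (y + y)) * R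
W-algebra y q₀ q₁ q₂ h₀ h₁ Y R c κ/2 step₁ step₂ ratio coeff 1-y≢0 = *-cancelˡ-≢0 (1ℚ - y) _ _ 1-y≢0 (begin
  (1ℚ - y) * ((c + c) * (q₁ * q₁ - q₀ * q₂))
    ≡⟨ solve 5 (λ y q₀ q₁ q₂ c → (con 1ℚ :- y) :* ((c :+ c) :* (q₁ :* q₁ :- q₀ :* q₂)) := (c :+ c) :* (q₁ :* ((con 1ℚ :- y) :* q₁) :- q₀ :* ((con 1ℚ :- y) :* q₂))) refl y q₀ q₁ q₂ c ⟩
  (c + c) * (q₁ * ((1ℚ - y) * q₁) - q₀ * ((1ℚ - y) * q₂))
    ≡⟨ cong₂ (λ s t → (c + c) * (q₁ * s - q₀ * t)) step₁ step₂ ⟩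
  (c + c) * (q₁ * (q₀ + h₀ * Y * (1ℚ - (y + y))) - q₀ * (q₁ + h₁ * (y * Y) * (1ℚ - (y + y))))
    ≡⟨ solve 7 (λ y q₀ q₁ h₀ h₁ Y c → (c :+ c) :* (q₁ :* (q₀ :+ h₀ :* Y :* (con 1ℚ :- (y :+ y))) :- q₀ :* (q₁ :+ h₁ :* (y :* Y) :* (con 1ℚ :- (y :+ y))))
         := Y :* (con 1ℚ :- (y :+ y)) :* ((h₀ :+ h₀) :* (c :* q₁) :- (c :* h₁ :+ c :* h₁) :* (y :* q₀))) refl y q₀ q₁ h₀ h₁ Y c ⟩
  Y * (1ℚ - (y + y)) * ((h₀ + h₀) * (c * q₁) - (c * h₁ + c * h₁) * (y * q₀))
    ≡⟨ cong (λ s → Y * (1ℚ - (y + y)) * ((h₀ + h₀) * (c * q₁) - (s + s) * (y * q₀))) ratio ⟩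
  Y * (1ℚ - (y + y)) * ((h₀ + h₀) * (c * q₁) - (κ/2 * (h₀ + h₀) + κ/2 * (h₀ + h₀)) * (y * q₀))
    ≡⟨ solve 7 (λ y q₀ q₁ h₀ Y c k → Y :* (con 1ℚ :- (y :+ y)) :* ((h₀ :+ h₀) :* (c :* q₁) :- (k :* (h₀ :+ h₀) :+ k :* (h₀ :+ h₀)) :* (y :* q₀))
         := (h₀ :+ h₀) :* Y :* (con 1ℚ :- (y :+ y)) :* (c :* q₁ :- (k :+ k) :* (y :* q₀))) refl y q₀ q₁ h₀ Y c κ/2 ⟩
  (h₀ + h₀) * Y * (1ℚ - (y + y)) * (c * q₁ - (κ/2 + κ/2) * (y * q₀))
    ≡⟨ cong ((h₀ + h₀) * Y * (1ℚ - (y + y)) *_) coeff ⟩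
  (h₀ + h₀) * Y * (1ℚ - (y + y)) * ((1ℚ - y) * R)
    ≡⟨ solve 4 (λ y h₀ Y R → (h₀ :+ h₀) :* Y :* (con 1ℚ :- (y :+ y)) :* ((con 1ℚ :- y) :* R) := (con 1ℚ :- y) :* ((h₀ :+ h₀) :* Y :* (con 1ℚ :- (y :+ y)) :* R)) refl y h₀ Y R ⟩
  (1ℚ - y) * ((h₀ + h₀) * Y * (1ℚ - (y + y)) * R) ∎)
  where open ≡-Reasoning

module Turán (p : ℕ) where
  open RHS-Coefficients p

  -- c H_n = (2n+1) · 2H_{n-1} with c = n + 1, i.e. the ratio of consecutive
  -- central binomial coefficients C(2n+2, n+1) / C(2n, n).
  H-ratio : (1ℚ + N) * H (suc p) ≡ (N + (1ℚ + N)) * (H p + H p)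
  H-ratio = begin
    (1ℚ + N) * H (suc p)                                 ≡⟨ cong (_* H (suc p)) (ℕ→ℚ-suc (suc p)) ⟨
    ℕ→ℚ (suc (suc p)) * H (suc p)                        ≡⟨ ℕ→ℚ-* (suc (suc p)) (M (suc p) (suc (suc p))) ⟨
    ℕ→ℚ (suc (suc p) ℕ.* M (suc p) (suc (suc p)))        ≡⟨ cong (λ z → ℕ→ℚ (suc (suc p) ℕ.* z)) (M-sym (suc p) (suc (suc p))) ⟩
    ℕ→ℚ (suc (suc p) ℕ.* M (suc (suc p)) (suc p))        ≡⟨ cong ℕ→ℚ (absorption (suc p) (suc p)) ⟩
    ℕ→ℚ ((suc (suc p) ℕ.+ suc p) ℕ.* M (suc p) (suc p))  ≡⟨ ℕ→ℚ-* (suc (suc p) ℕ.+ suc p) (M (suc p) (suc p)) ⟩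
    ℕ→ℚ (suc (suc p) ℕ.+ suc p) * ℕ→ℚ (M (suc p) (suc p)) ≡⟨ cong₂ _*_ 2n+1 (M-diagonal p) ⟩
    (N + (1ℚ + N)) * (H p + H p)                         ∎
    where
    open ≡-Reasoning
    2n+1 : ℕ→ℚ (suc (suc p) ℕ.+ suc p) ≡ N + (1ℚ + N)
    2n+1 = trans (cong ℕ→ℚ (ℕP.+-comm (suc (suc p)) (suc p))) (trans (ℕ→ℚ-+ (suc p) (suc (suc p))) (cong (λ z → N + z) (ℕ→ℚ-suc (suc p))))

  -- The two sides of the identity 2(n+1)·W(y) = C(2n, n) y^n (1 - 2y) R_n(y), as
  -- functions of y, in the form produced by W-algebra.
  lhs rhs : ℚ → ℚ
  lhs y = ((1ℚ + N) + (1ℚ + N)) * W p y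
  rhs y = (H p + H p) * y ^ suc p * (1ℚ - (y + y)) * RHS (suc p) y

  identity-off-1 : ∀ y → 1ℚ - y ≢ 0ℚ → lhs y ≡ rhs y
  identity-off-1 y = W-algebra y (q p y) (q (suc p) y) (q (suc (suc p)) y) (H p) (H (suc p)) (y ^ suc p) (RHS (suc p) y)
                               (1ℚ + N) (N + (1ℚ + N)) (q-step p y) (q-step (suc p) y) H-ratio (coefficient-identity y)

  -- Both sides are polynomial functions, and they agree at 2, 3, 4, …
  identity : ∀ y → lhs y ≡ rhs y
  identity = poly-identity poly-lhs poly-rhs 2 (λ i → identity-off-1 (ℕ→ℚ (2 ℕ.+ i)) (1-y≢0 i))
    where
    poly-lhs : IsPoly lhs
    poly-lhs = poly-* (poly-const ((1ℚ + N) + (1ℚ + N))) (poly-- (poly-* (poly-q (suc p) poly-id) (poly-q (suc p) poly-id))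
                                              (poly-* (poly-q p poly-id) (poly-q (suc (suc p)) poly-id)))
    poly-RHS : IsPoly (RHS (suc p))
    poly-RHS = poly-ext RHS≡Σρ (poly-sum (suc p) (λ k y → ρ k * y ^ k) (λ k → poly-* (poly-const (ρ k)) (poly-^ poly-id k)))
    poly-rhs : IsPoly rhs
    poly-rhs = poly-* (poly-* (poly-* (poly-const (H p + H p)) (poly-^ poly-id (suc p))) (poly-- (poly-const 1ℚ) (poly-+ poly-id poly-id))) poly-RHS
    1-y≢0 : ∀ i → 1ℚ - ℕ→ℚ (2 ℕ.+ i) ≢ 0ℚ
    1-y≢0 i eq = ℕ→ℚ-suc≢0 i (begin
      ℕ→ℚ (suc i)                    ≡⟨ solve 1 (λ X → X := :- (con 1ℚ :- (con 1ℚ :+ X))) refl (ℕ→ℚ (suc i)) ⟩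
      - (1ℚ - (1ℚ + ℕ→ℚ (suc i)))    ≡⟨ cong (λ z → - (1ℚ - z)) (ℕ→ℚ-suc (suc i)) ⟨
      - (1ℚ - ℕ→ℚ (2 ℕ.+ i))         ≡⟨ cong -_ eq ⟩
      0ℚ                             ∎)
      where open ≡-Reasoning

  2[n+1] : ℕ→ℚ (2 ℕ.* (suc p ℕ.+ 1)) ≡ (1ℚ + N) + (1ℚ + N)
  2[n+1] = trans (cong ℕ→ℚ (cong₂ ℕ._+_ n+1≡1+n (trans (ℕP.+-identityʳ (suc p ℕ.+ 1)) n+1≡1+n)))
                 (trans (ℕ→ℚ-+ (suc (suc p)) (suc (suc p))) (cong₂ _+_ (ℕ→ℚ-suc (suc p)) (ℕ→ℚ-suc (suc p))))
    where
    n+1≡1+n : suc p ℕ.+ 1 ≡ suc (suc p)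
    n+1≡1+n = ℕP.+-comm (suc p) 1

  central-binomial : H p + H p ≡ ℕ→ℚ ((2 ℕ.* suc p) C suc p)
  central-binomial = trans (sym (M-diagonal p))
    (cong ℕ→ℚ (trans (M≡C (suc p) (suc p)) (cong (_C suc p) (sym (cong (suc p ℕ.+_) (ℕP.+-identityʳ (suc p)))))))

  main-identity : ∀ y → ℕ→ℚ (2 ℕ.* (suc p ℕ.+ 1)) * W p y
                        ≡ ℕ→ℚ ((2 ℕ.* suc p) C suc p) * y ^ suc p * (1ℚ - two * y) * RHS (suc p) y
  main-identity y = begin
    ℕ→ℚ (2 ℕ.* (suc p ℕ.+ 1)) * W p y                    ≡⟨ cong (_* W p y) 2[n+1] ⟩
    lhs y                                               ≡⟨ identity y ⟩
    rhs y                                               ≡⟨ cong₂ (λ c t → c * y ^ suc p * (1ℚ - t) * RHS (suc p) y) central-binomial 2y ⟩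
    ℕ→ℚ ((2 ℕ.* suc p) C suc p) * y ^ suc p * (1ℚ - two * y) * RHS (suc p) y ∎
    where
    open ≡-Reasoning
    2y : y + y ≡ two * y
    2y = solve 1 (λ Y → Y :+ Y := (con 1ℚ :+ con 1ℚ) :* Y) refl y

-- With Q_m(-x) = q_m(x), V_n(x) is the left-hand side of main-identity
-- divided by C(2n, n) x^n (1 - 2x).
theorem7p2 : (P Q : (m : ℕ) → Poly m) → IsPQ P Q →
    (n : ℕ) .{{_ : ℕ.NonZero n}} (x : ℚ) →
    (nz : ℕ→ℚ ((2 ℕ.* n) C n) * (x ^ n) * (1ℚ - two * x) ≢ 0ℚ) →
    V Q n x {{≢-nonZero nz}} ≡ RHS n x
theorem7p2 P Q isPQ n@(suc p) x nz = divide-out (ℕ→ℚ (2 ℕ.* (n ℕ.+ 1))) Ŵ D (RHS n x) nz (begin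
  ℕ→ℚ (2 ℕ.* (n ℕ.+ 1)) * Ŵ      ≡⟨ cong (ℕ→ℚ (2 ℕ.* (n ℕ.+ 1)) *_) Ŵ≡W ⟩
  ℕ→ℚ (2 ℕ.* (n ℕ.+ 1)) * W p x  ≡⟨ Turán.main-identity p x ⟩
  D * RHS n x                    ∎)
  where
  open ≡-Reasoning
  D : ℚ
  D = ℕ→ℚ ((2 ℕ.* n) C n) * x ^ n * (1ℚ - two * x)
  Q̂ : ℕ → ℚ
  Q̂ m = eval (Q m) (- x)
  Ŵ : ℚ
  Ŵ = Q̂ n * Q̂ n - Q̂ p * Q̂ (suc n)
  Q̂≡q : ∀ m → Q̂ m ≡ q m x
  Q̂≡q m = trans (Q≡q P Q isPQ m (- x)) (cong (q m) (solve 1 (λ X → :- (:- X) := X) refl x))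
  Ŵ≡W : Ŵ ≡ W p x
  Ŵ≡W = cong₂ _-_ (cong₂ _*_ (Q̂≡q n) (Q̂≡q n)) (cong₂ _*_ (Q̂≡q p) (Q̂≡q (suc n)))
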